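{- For all nonempty sequences of literals $\vec p,\vec q$, the following sequents have cut-free tree-like ${\mathrm{LDT}}$ proofs of size polynomial in the total length of $\vec p,\vec q$: (a) ${\mathrm{Conj}}(\vec p,\vec q)\to{\mathrm{Conj}}(\vec p)$; (b) ${\mathrm{Conj}}(\vec p,\vec q)\to{\mathrm{Conj}}(\vec q)$; (c) ${\mathrm{Conj}}(\vec p),{\mathrm{Conj}}(\vec q)\to{\mathrm{Conj}}(\vec p,\vec q)$; (d) ${\mathrm{Disj}}(\vec p)\to{\mathrm{Disj}}(\vec p,\vec q)$; (e) ${\mathrm{Disj}}(\vec q)\to{\mathrm{Disj}}(\vec p,\vec q)$; (f) ${\mathrm{Disj}}(\vec p,\vec q)\to{\mathrm{Disj}}(\vec p),{\mathrm{Disj}}(\vec q)$.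
   Context: A literal is a propositional variable $x$ or its negation $\overline x$. DT formulas: literals, and $(ApB)$ for DT formulas $A,B$ and literal $p$ ("if $p$ is false then $A$, else $B$"). For a nonempty sequence of literals: ${\mathrm{Conj}}(p):=p$, ${\mathrm{Conj}}(p,\vec p):=(p\,p\,{\mathrm{Conj}}(\vec p))$; ${\mathrm{Disj}}(p):=p$, ${\mathrm{Disj}}(p,\vec p):=({\mathrm{Disj}}(\vec p)\,p\,p)$; $(\vec p,\vec q)$ denotes concatenation. ${\mathrm{LDT}}$: lines are sequents $\Gamma\to\Delta$ of DT formulas ($\Gamma,\Delta$ multisets); initial sequents $p\to p$, $p,\overline p\to$, $\to p,\overline p$; rules contraction, weakening (left and right), cut, dec-l (from $A,\Gamma\to\Delta,p$ and $p,B,\Gamma\to\Delta$ infer $ApB,\Gamma\to\Delta$), dec-r (from $\Gamma\to\Delta,A,p$ and $p,\Gamma\to\Delta,B$ infer $\Gamma\to\Delta,ApB$). Tree-like: each sequent used at most once as a premise; cut-free: no cut. Proof size = sum of sizes (number of atomic occurrences) of formulas. -}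

module Defs where

open import Data.Nat using (ℕ; zero; suc; _+_; _*_; _^_; _≤_)
open import Data.Bool using (Bool; true; false; not)
open import Data.List using (List; []; _∷_; _++_)
open import Data.List.NonEmpty using (List⁺; _∷_; _⁺++⁺_) renaming (length to length⁺)
open import Data.List.Relation.Binary.Permutation.Propositional using (_↭_)
open import Data.Product using (Σ; _×_; _,_)

-- A literal: a propositional variable (indexed by ℕ) with a polarity;
-- polarity true = the variable x, false = its negation x̄.
record Lit : Set where
  constructor lit
  field
    var : ℕ
    pos : Bool

neg : Lit → Lit
neg (lit x b) = lit x (not b)

-- DT formulas: literals and  (A p B)  = "if p is false then A else B"
data Form : Set where
  ` : Lit → Form
  dec : Form → Lit → Form → Form

size : Form → ℕ
size (` p) = 1
size (dec A p B) = size A + 1 + size B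

sizeL : List Form → ℕ
sizeL [] = 0
sizeL (A ∷ As) = size A + sizeL As

conj : Lit → List Lit → Form
conj p [] = ` p
conj p (q ∷ qs) = dec (` p) p (conj q qs)

disj : Lit → List Lit → Form
disj p [] = ` p
disj p (q ∷ qs) = dec (disj q qs) p (` p)

Conj : List⁺ Lit → Form
Conj (p ∷ ps) = conj p ps

Disj : List⁺ Lit → Form
Disj (p ∷ ps) = disj p ps

-- Sequents Γ → Δ with Γ, Δ multisets: represented by lists, every rule's
-- conclusion (and the initial sequents) taken up to permutation of each side.
record Sequent : Set where
  constructor _⇒_
  field
    ante : List Form
    succ : List Form

infix 4 _⇒_

-- LDT derivations (trees, hence tree-like by construction).
data LDT : Sequent → Set where
  ax    : ∀ {Γ Δ} p → Γ ↭ (` p ∷ []) → Δ ↭ (` p ∷ []) → LDT (Γ ⇒ Δ)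
  axL   : ∀ {Γ} p → Γ ↭ (` p ∷ ` (neg p) ∷ []) → LDT (Γ ⇒ [])
  axR   : ∀ {Δ} p → Δ ↭ (` p ∷ ` (neg p) ∷ []) → LDT ([] ⇒ Δ)
  contrL : ∀ {Γ Δ Γ'} A → Γ' ↭ (A ∷ Γ) → LDT ((A ∷ A ∷ Γ) ⇒ Δ) → LDT (Γ' ⇒ Δ)
  contrR : ∀ {Γ Δ Δ'} A → Δ' ↭ (Δ ++ A ∷ []) → LDT (Γ ⇒ (Δ ++ A ∷ A ∷ [])) → LDT (Γ ⇒ Δ')
  weakL : ∀ {Γ Δ Γ'} A → Γ' ↭ (A ∷ Γ) → LDT (Γ ⇒ Δ) → LDT (Γ' ⇒ Δ)
  weakR : ∀ {Γ Δ Δ'} A → Δ' ↭ (Δ ++ A ∷ []) → LDT (Γ ⇒ Δ) → LDT (Γ ⇒ Δ')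
  cut   : ∀ {Γ Δ Γ' Δ'} A → Γ' ↭ Γ → Δ' ↭ Δ →
          LDT (Γ ⇒ (Δ ++ A ∷ [])) → LDT ((A ∷ Γ) ⇒ Δ) → LDT (Γ' ⇒ Δ')
  decL  : ∀ {Γ Δ Γ'} A p B → Γ' ↭ (dec A p B ∷ Γ) →
          LDT ((A ∷ Γ) ⇒ (Δ ++ ` p ∷ [])) → LDT ((` p ∷ B ∷ Γ) ⇒ Δ) → LDT (Γ' ⇒ Δ)
  decR  : ∀ {Γ Δ Δ'} A p B → Δ' ↭ (Δ ++ dec A p B ∷ []) →
          LDT (Γ ⇒ (Δ ++ A ∷ ` p ∷ [])) → LDT ((` p ∷ Γ) ⇒ (Δ ++ B ∷ [])) → LDT (Γ ⇒ Δ')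

data CutFree : ∀ {S} → LDT S → Set where
  ax    : ∀ {Γ Δ p e f} → CutFree (ax {Γ} {Δ} p e f)
  axL   : ∀ {Γ p e} → CutFree (axL {Γ} p e)
  axR   : ∀ {Δ p e} → CutFree (axR {Δ} p e)
  contrL : ∀ {Γ Δ Γ' A e d} → CutFree d → CutFree (contrL {Γ} {Δ} {Γ'} A e d)
  contrR : ∀ {Γ Δ Δ' A e d} → CutFree d → CutFree (contrR {Γ} {Δ} {Δ'} A e d)
  weakL : ∀ {Γ Δ Γ' A e d} → CutFree d → CutFree (weakL {Γ} {Δ} {Γ'} A e d)
  weakR : ∀ {Γ Δ Δ' A e d} → CutFree d → CutFree (weakR {Γ} {Δ} {Δ'} A e d)
  decL  : ∀ {Γ Δ Γ' A p B e d₁ d₂} → CutFree d₁ → CutFree d₂ →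
          CutFree (decL {Γ} {Δ} {Γ'} A p B e d₁ d₂)
  decR  : ∀ {Γ Δ Δ' A p B e d₁ d₂} → CutFree d₁ → CutFree d₂ →
          CutFree (decR {Γ} {Δ} {Δ'} A p B e d₁ d₂)

seqSize : Sequent → ℕ
seqSize (Γ ⇒ Δ) = sizeL Γ + sizeL Δ

proofSize : ∀ {S} → LDT S → ℕ
proofSize {S} (ax p e f) = seqSize S
proofSize {S} (axL p e) = seqSize S
proofSize {S} (axR p e) = seqSize S
proofSize {S} (contrL A e d) = seqSize S + proofSize d
proofSize {S} (contrR A e d) = seqSize S + proofSize d
proofSize {S} (weakL A e d) = seqSize S + proofSize d
proofSize {S} (weakR A e d) = seqSize S + proofSize d
proofSize {S} (cut A e f d₁ d₂) = seqSize S + proofSize d₁ + proofSize d₂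
proofSize {S} (decL A p B e d₁ d₂) = seqSize S + proofSize d₁ + proofSize d₂
proofSize {S} (decR A p B e d₁ d₂) = seqSize S + proofSize d₁ + proofSize d₂

HasCFProof : Sequent → ℕ → Set
HasCFProof S b = Σ (LDT S) λ d → CutFree d × proofSize d ≤ b

-- Each sequent is proved by induction on the first sequence.  Peeling the outermost literal off
-- Conj(p, ps) = (p p Conj(ps)) or Disj(p, ps) = (Disj(ps) p p) costs a constant number of
-- dec- and weakening inferences, and the base cases need the identity F → F, which has a proof
-- with O(size F) lines.  No inference used has a premise larger than its conclusion, and every
-- sequent involved has size O(n), so a proof with O(n) lines has size O(n²).
module Submission where

open import Defs
open import Data.Nat
open import Data.Nat.Properties
open import Data.Nat.ListAction using (sum)
open import Data.Nat.ListAction.Properties using (sum-↭)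
open import Data.Nat.Tactic.RingSolver using (solve-∀)
open import Data.List using ([]; _∷_; _++_; map)
open import Data.List.NonEmpty using (List⁺; _∷_; _⁺++⁺_) renaming (length to length⁺)
open import Data.List.NonEmpty.Properties using (length-⁺++⁺)
open import Data.List.Relation.Binary.Permutation.Propositional
  using (_↭_; refl; prep; swap; ↭-sym; ↭-trans)
open import Data.List.Relation.Binary.Permutation.Propositional.Properties using (map⁺; ++-comm)
open import Data.Product using (Σ; _×_; _,_)
open import Function using (_$_)
open import Relation.Binary.PropositionalEquality
  using (_≡_; refl; sym; trans; cong; cong₂; subst)

sizeL≡sum : ∀ Γ → sizeL Γ ≡ sum (map size Γ)
sizeL≡sum []      = refl
sizeL≡sum (A ∷ Γ) = cong (size A +_) (sizeL≡sum Γ)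

sizeL-↭ : ∀ {Γ Γ'} → Γ ↭ Γ' → sizeL Γ ≡ sizeL Γ'
sizeL-↭ {Γ} {Γ'} e =
  trans (sizeL≡sum Γ) (trans (sum-↭ (map⁺ size e)) (sym (sizeL≡sum Γ')))

sizeL-++ : ∀ Γ Δ → sizeL (Γ ++ Δ) ≡ sizeL Γ + sizeL Δ
sizeL-++ []      Δ = refl
sizeL-++ (A ∷ Γ) Δ = trans (cong (size A +_) (sizeL-++ Γ Δ)) (sym (+-assoc (size A) _ _))

sizeL-∷-≤ : ∀ {Γ Γ'} A → Γ' ↭ A ∷ Γ → sizeL Γ ≤ sizeL Γ'
sizeL-∷-≤ {Γ} A e = subst (sizeL Γ ≤_) (sizeL-↭ (↭-sym e)) (m≤n+m (sizeL Γ) (size A))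

sizeL-∷ʳ-≤ : ∀ {Δ Δ'} A → Δ' ↭ Δ ++ A ∷ [] → sizeL Δ ≤ sizeL Δ'
sizeL-∷ʳ-≤ {Δ} A e = sizeL-∷-≤ A (↭-trans e (++-comm Δ (A ∷ [])))

-- m stands for the number of lines: the inferences below never have a premise larger than
-- their conclusion, so a proof of S built from them with m lines has size at most m · seqSize S.
record HasCFProofOfLength (m : ℕ) (S : Sequent) : Set where
  constructor byLength
  field
    cfProof : HasCFProof S (m * seqSize S)

lengthen : ∀ {m m' S} → m ≤ m' → HasCFProofOfLength m S → HasCFProofOfLength m' S
lengthen {S = S} m≤m' (byLength (d , c , h)) =
  byLength (d , c , ≤-trans h (*-monoˡ-≤ (seqSize S) m≤m'))

recount : ∀ {m m' S} → m ≡ m' → HasCFProofOfLength m S → HasCFProofOfLength m' S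
recount refl d = d

rule₁-size-≤ : ∀ {s s' x m} → s ≤ s' → x ≤ m * s → s' + x ≤ suc m * s'
rule₁-size-≤ {s' = s'} {m = m} s≤s' h = +-monoʳ-≤ s' (≤-trans h (*-monoʳ-≤ m s≤s'))

rule₂-size-≤ : ∀ {s₁ s₂ s' x₁ x₂ m₁ m₂} → s₁ ≤ s' → s₂ ≤ s' →
               x₁ ≤ m₁ * s₁ → x₂ ≤ m₂ * s₂ → s' + x₁ + x₂ ≤ suc (m₁ + m₂) * s'
rule₂-size-≤ {s' = s'} {x₁} {x₂} {m₁} {m₂} s₁≤s' s₂≤s' h₁ h₂ = begin
  s' + x₁ + x₂             ≤⟨ +-mono-≤ (+-monoʳ-≤ s' (≤-trans h₁ (*-monoʳ-≤ m₁ s₁≤s')))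
                                        (≤-trans h₂ (*-monoʳ-≤ m₂ s₂≤s')) ⟩
  s' + m₁ * s' + m₂ * s'   ≡⟨ +-assoc s' _ _ ⟩
  s' + (m₁ * s' + m₂ * s') ≡⟨ cong (s' +_) (*-distribʳ-+ s' m₁ m₂) ⟨
  suc (m₁ + m₂) * s'       ∎
  where open ≤-Reasoning

decL-premise₁-≤ : ∀ a b g d {x y} → x ≡ d + 1 → y ≡ a + 1 + b + g → a + g + x ≤ y + d
decL-premise₁-≤ a b g d refl refl = m+n≤o⇒m≤o _ (≤-reflexive (eq a b g d))
  where
  eq : ∀ a b g d → a + g + (d + 1) + b ≡ a + 1 + b + g + d
  eq = solve-∀

decL-premise₂-≤ : ∀ a b g d {y} → y ≡ a + 1 + b + g → suc (b + g + d) ≤ y + d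
decL-premise₂-≤ a b g d refl = m+n≤o⇒m≤o _ (≤-reflexive (eq a b g d))
  where
  eq : ∀ a b g d → suc (b + g + d) + a ≡ a + 1 + b + g + d
  eq = solve-∀

decR-premise₁-≤ : ∀ a b g d {x y} → x ≡ d + (a + 1) → y ≡ d + (a + 1 + b + 0) →
                  g + x ≤ g + y
decR-premise₁-≤ a b g d refl refl = m+n≤o⇒m≤o _ (≤-reflexive (eq a b g d))
  where
  eq : ∀ a b g d → g + (d + (a + 1)) + b ≡ g + (d + (a + 1 + b + 0))
  eq = solve-∀

decR-premise₂-≤ : ∀ a b g d {x y} → x ≡ d + (b + 0) → y ≡ d + (a + 1 + b + 0) →
                  suc (g + x) ≤ g + y
decR-premise₂-≤ a b g d refl refl = m+n≤o⇒m≤o _ (≤-reflexive (eq a b g d))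
  where
  eq : ∀ a b g d → suc (g + (d + (b + 0))) + a ≡ g + (d + (a + 1 + b + 0))
  eq = solve-∀

axiom : ∀ p → HasCFProofOfLength 1 ((` p ∷ []) ⇒ (` p ∷ []))
axiom p = byLength (ax p refl refl , ax , ≤-refl)

weakenL : ∀ {Γ Δ Γ' m} A → Γ' ↭ A ∷ Γ →
          HasCFProofOfLength m (Γ ⇒ Δ) → HasCFProofOfLength (suc m) (Γ' ⇒ Δ)
weakenL {Δ = Δ} {m = m} A e (byLength (d , c , h)) =
  byLength (weakL A e d , weakL c ,
            rule₁-size-≤ {m = m} (+-monoˡ-≤ (sizeL Δ) (sizeL-∷-≤ A e)) h)

weakenR : ∀ {Γ Δ Δ' m} A → Δ' ↭ Δ ++ A ∷ [] →
          HasCFProofOfLength m (Γ ⇒ Δ) → HasCFProofOfLength (suc m) (Γ ⇒ Δ')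
weakenR {Γ} {m = m} A e (byLength (d , c , h)) =
  byLength (weakR A e d , weakR c ,
            rule₁-size-≤ {m = m} (+-monoʳ-≤ (sizeL Γ) (sizeL-∷ʳ-≤ A e)) h)

decideL : ∀ {Γ Δ Γ' m₁ m₂} A p B → Γ' ↭ dec A p B ∷ Γ →
          HasCFProofOfLength m₁ ((A ∷ Γ) ⇒ (Δ ++ ` p ∷ [])) →
          HasCFProofOfLength m₂ ((` p ∷ B ∷ Γ) ⇒ Δ) →
          HasCFProofOfLength (suc (m₁ + m₂)) (Γ' ⇒ Δ)
decideL {Γ} {Δ} {Γ'} {m₁} {m₂} A p B e (byLength (d₁ , c₁ , h₁)) (byLength (d₂ , c₂ , h₂)) =
  byLength (decL A p B e d₁ d₂ , decL c₁ c₂ ,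
            rule₂-size-≤ {m₁ = m₁} {m₂} premise₁-≤ premise₂-≤ h₁ h₂)
  where
  premise₁-≤ : seqSize ((A ∷ Γ) ⇒ (Δ ++ ` p ∷ [])) ≤ seqSize (Γ' ⇒ Δ)
  premise₁-≤ = decL-premise₁-≤ (size A) (size B) (sizeL Γ) (sizeL Δ)
                               (sizeL-++ Δ (` p ∷ [])) (sizeL-↭ e)
  premise₂-≤ : seqSize ((` p ∷ B ∷ Γ) ⇒ Δ) ≤ seqSize (Γ' ⇒ Δ)
  premise₂-≤ = decL-premise₂-≤ (size A) (size B) (sizeL Γ) (sizeL Δ) (sizeL-↭ e)

decideR : ∀ {Γ Δ Δ' m₁ m₂} A p B → Δ' ↭ Δ ++ dec A p B ∷ [] →
          HasCFProofOfLength m₁ (Γ ⇒ (Δ ++ A ∷ ` p ∷ [])) →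
          HasCFProofOfLength m₂ ((` p ∷ Γ) ⇒ (Δ ++ B ∷ [])) →
          HasCFProofOfLength (suc (m₁ + m₂)) (Γ ⇒ Δ')
decideR {Γ} {Δ} {Δ'} {m₁} {m₂} A p B e (byLength (d₁ , c₁ , h₁)) (byLength (d₂ , c₂ , h₂)) =
  byLength (decR A p B e d₁ d₂ , decR c₁ c₂ ,
            rule₂-size-≤ {m₁ = m₁} {m₂} premise₁-≤ premise₂-≤ h₁ h₂)
  where
  sizeL-Δ' : sizeL Δ' ≡ sizeL Δ + (size A + 1 + size B + 0)
  sizeL-Δ' = trans (sizeL-↭ e) (sizeL-++ Δ (dec A p B ∷ []))
  premise₁-≤ : seqSize (Γ ⇒ (Δ ++ A ∷ ` p ∷ [])) ≤ seqSize (Γ ⇒ Δ')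
  premise₁-≤ = decR-premise₁-≤ (size A) (size B) (sizeL Γ) (sizeL Δ)
                               (sizeL-++ Δ (A ∷ ` p ∷ [])) sizeL-Δ'
  premise₂-≤ : seqSize ((` p ∷ Γ) ⇒ (Δ ++ B ∷ [])) ≤ seqSize (Γ ⇒ Δ')
  premise₂-≤ = decR-premise₂-≤ (size A) (size B) (sizeL Γ) (sizeL Δ)
                               (sizeL-++ Δ (B ∷ [])) sizeL-Δ'

-- (p p A) and (A p p) are the decision-tree forms of p ∧ A and A ∨ p; conj and disj iterate them.
infixr 6 _∧ᵈ_
infixl 6 _∨ᵈ_

_∧ᵈ_ : Lit → Form → Form
p ∧ᵈ A = dec (` p) p A

_∨ᵈ_ : Form → Lit → Form
A ∨ᵈ p = dec A p (` p)

⟨_⟩⇒⟨_⟩ : Form → Form → Sequent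
⟨ A ⟩⇒⟨ B ⟩ = (A ∷ []) ⇒ (B ∷ [])

∧ᵈ-elimˡ : ∀ p A → HasCFProofOfLength 5 ⟨ p ∧ᵈ A ⟩⇒⟨ ` p ⟩
∧ᵈ-elimˡ p A = decideL {Δ = ` p ∷ []} (` p) p A refl
  (weakenR (` p) refl (axiom p))
  (weakenL A (swap _ _ refl) (axiom p))

∧ᵈ-elimʳ : ∀ {m} p {A C} → HasCFProofOfLength m ⟨ A ⟩⇒⟨ C ⟩ →
           HasCFProofOfLength (4 + m) ⟨ p ∧ᵈ A ⟩⇒⟨ C ⟩
∧ᵈ-elimʳ p {A} {C} A⇒C = decideL {Δ = C ∷ []} (` p) p A refl
  (weakenR C (swap _ _ refl) (axiom p))
  (weakenL (` p) refl A⇒C)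

∧ᵈ-intro : ∀ {m} p {A} → HasCFProofOfLength m ⟨ A ⟩⇒⟨ A ⟩ →
           HasCFProofOfLength (6 + m) ((` p ∷ A ∷ []) ⇒ (p ∧ᵈ A ∷ []))
∧ᵈ-intro p {A} A⇒A = decideR {Δ = []} (` p) p A refl
  (weakenL A (swap _ _ refl) (weakenR (` p) refl (axiom p)))
  (weakenL (` p) refl (weakenL (` p) refl A⇒A))

∧ᵈ-monoʳ : ∀ {m} p {A B} → HasCFProofOfLength m ⟨ A ⟩⇒⟨ B ⟩ →
           HasCFProofOfLength (9 + m) ⟨ p ∧ᵈ A ⟩⇒⟨ p ∧ᵈ B ⟩
∧ᵈ-monoʳ p {A} {B} A⇒B = decideL {Δ = p ∧ᵈ B ∷ []} (` p) p A refl
  (weakenR (p ∧ᵈ B) (swap _ _ refl) (axiom p))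
  (decideR {Δ = []} (` p) p B refl
    (weakenL A (swap _ _ refl) (weakenR (` p) refl (axiom p)))
    (weakenL (` p) refl (weakenL (` p) refl A⇒B)))

∧ᵈ-monoʳ-ctx : ∀ {m} p {A B C} → HasCFProofOfLength m ((A ∷ C ∷ []) ⇒ (B ∷ [])) →
               HasCFProofOfLength (11 + m) ((p ∧ᵈ A ∷ C ∷ []) ⇒ (p ∧ᵈ B ∷ []))
∧ᵈ-monoʳ-ctx p {A} {B} {C} A,C⇒B =
  decideL {Γ = C ∷ []} {Δ = p ∧ᵈ B ∷ []} (` p) p A refl
    (weakenL C (swap _ _ refl) (weakenR (p ∧ᵈ B) (swap _ _ refl) (axiom p)))
    (decideR {Δ = []} (` p) p B refl
      (weakenR (` p) refl (weakenL A (swap _ _ refl) (weakenL C (swap _ _ refl) (axiom p))))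
      (weakenL (` p) refl (weakenL (` p) refl A,C⇒B)))

∨ᵈ-introʳ : ∀ p A → HasCFProofOfLength 5 ⟨ ` p ⟩⇒⟨ A ∨ᵈ p ⟩
∨ᵈ-introʳ p A = decideR {Δ = []} A p (` p) refl
  (weakenR A (swap _ _ refl) (axiom p))
  (weakenL (` p) refl (axiom p))

∨ᵈ-introˡ : ∀ {m} p {A C} → HasCFProofOfLength m ⟨ C ⟩⇒⟨ A ⟩ →
            HasCFProofOfLength (4 + m) ⟨ C ⟩⇒⟨ A ∨ᵈ p ⟩
∨ᵈ-introˡ {m} p {A} {C} C⇒A = recount (cong (2 +_) (+-comm m 2)) $
  decideR {Δ = []} A p (` p) refl
    (weakenR (` p) refl C⇒A)
    (weakenL C (swap _ _ refl) (axiom p))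

∨ᵈ-elim : ∀ {m} p {A} → HasCFProofOfLength m ⟨ A ⟩⇒⟨ A ⟩ →
          HasCFProofOfLength (6 + m) ((A ∨ᵈ p ∷ []) ⇒ (` p ∷ A ∷ []))
∨ᵈ-elim {m} p {A} A⇒A = recount (cong (3 +_) (+-comm m 3)) $
  decideL {Δ = ` p ∷ A ∷ []} A p (` p) refl
    (weakenR (` p) refl (weakenR (` p) (swap _ _ refl) A⇒A))
    (weakenL (` p) refl (weakenR A refl (axiom p)))

∨ᵈ-monoˡ : ∀ {m} p {A B} → HasCFProofOfLength m ⟨ A ⟩⇒⟨ B ⟩ →
           HasCFProofOfLength (13 + m) ⟨ A ∨ᵈ p ⟩⇒⟨ B ∨ᵈ p ⟩
∨ᵈ-monoˡ {m} p {A} {B} A⇒B =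
  recount (cong (4 +_) (trans (+-assoc m 3 6) (+-comm m 9))) $
  decideL {Δ = B ∨ᵈ p ∷ []} A p (` p) refl
    (decideR {Δ = ` p ∷ []} B p (` p) (swap _ _ refl)
      (weakenR (` p) refl (weakenR (` p) (swap _ _ refl) A⇒B))
      (weakenL A (swap _ _ refl) (weakenR (` p) refl (axiom p))))
    (weakenL (` p) refl (∨ᵈ-introʳ p B))

∨ᵈ-monoˡ-ctx : ∀ {m} p {A B C} → HasCFProofOfLength m ((A ∷ []) ⇒ (B ∷ C ∷ [])) →
               HasCFProofOfLength (15 + m) ((A ∨ᵈ p ∷ []) ⇒ (B ∨ᵈ p ∷ C ∷ []))
∨ᵈ-monoˡ-ctx {m} p {A} {B} {C} A⇒B,C =
  recount (cong (4 +_) (trans (+-assoc m 4 7) (+-comm m 11))) $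
  decideL {Δ = B ∨ᵈ p ∷ C ∷ []} A p (` p) refl
    (decideR {Δ = C ∷ ` p ∷ []} B p (` p) (↭-trans (swap _ _ refl) (prep C (swap _ _ refl)))
      (weakenR (` p) refl
        (weakenR (` p) (↭-trans (prep C (swap _ _ refl)) (swap _ _ refl)) A⇒B,C))
      (weakenR (` p) refl
        (weakenR C (swap _ _ refl) (weakenL A (swap _ _ refl) (axiom p)))))
    (weakenR C refl (weakenL (` p) refl (∨ᵈ-introʳ p B)))

identity-length : ∀ a b → 4 + (a * 13 + 3 + (6 + b * 13)) ≡ (a + 1 + b) * 13
identity-length = solve-∀

identity : ∀ F → HasCFProofOfLength (size F * 13) ⟨ F ⟩⇒⟨ F ⟩
identity (` p)       = lengthen (≤ᵇ⇒≤ 1 13 _) (axiom p)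
identity (dec A p B) = recount (identity-length (size A) (size B)) $
  decideL {Δ = dec A p B ∷ []} A p B refl
    (decideR {Δ = ` p ∷ []} A p B (swap _ _ refl)
      (weakenR (` p) refl (weakenR (` p) (swap _ _ refl) (identity A)))
      (weakenR B refl (weakenL A (swap _ _ refl) (axiom p))))
    (decideR {Δ = []} A p B refl
      (weakenR A (swap _ _ refl) (weakenL B (swap _ _ refl) (axiom p)))
      (weakenL (` p) refl (weakenL (` p) refl (identity B))))

Conj-++-elimˡ : ∀ p ps qs → HasCFProofOfLength (length⁺ (p ∷ ps) * 9)
                                               ⟨ Conj ((p ∷ ps) ⁺++⁺ qs) ⟩⇒⟨ Conj (p ∷ ps) ⟩
Conj-++-elimˡ p []       (q ∷ qs) = lengthen (≤ᵇ⇒≤ 5 9 _) (∧ᵈ-elimˡ p (conj q qs))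
Conj-++-elimˡ p (r ∷ rs) (q ∷ qs) = ∧ᵈ-monoʳ p (Conj-++-elimˡ r rs (q ∷ qs))

Conj-++-elimʳ : ∀ p ps qs →
                HasCFProofOfLength (length⁺ (p ∷ ps) * 4 + size (Conj qs) * 13)
                                   ⟨ Conj ((p ∷ ps) ⁺++⁺ qs) ⟩⇒⟨ Conj qs ⟩
Conj-++-elimʳ p []       (q ∷ qs) = ∧ᵈ-elimʳ p (identity (conj q qs))
Conj-++-elimʳ p (r ∷ rs) (q ∷ qs) = ∧ᵈ-elimʳ p (Conj-++-elimʳ r rs (q ∷ qs))

Conj-++-intro : ∀ p ps qs →
                HasCFProofOfLength (length⁺ (p ∷ ps) * 11 + size (Conj qs) * 13)
                                   ((Conj (p ∷ ps) ∷ Conj qs ∷ []) ⇒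
                                    (Conj ((p ∷ ps) ⁺++⁺ qs) ∷ []))
Conj-++-intro p []       (q ∷ qs) =
  lengthen (+-monoˡ-≤ (size (conj q qs) * 13) (≤ᵇ⇒≤ 6 11 _))
           (∧ᵈ-intro p (identity (conj q qs)))
Conj-++-intro p (r ∷ rs) (q ∷ qs) = ∧ᵈ-monoʳ-ctx p (Conj-++-intro r rs (q ∷ qs))

Disj-++-introˡ : ∀ p ps qs → HasCFProofOfLength (length⁺ (p ∷ ps) * 13)
                                                ⟨ Disj (p ∷ ps) ⟩⇒⟨ Disj ((p ∷ ps) ⁺++⁺ qs) ⟩
Disj-++-introˡ p []       (q ∷ qs) = lengthen (≤ᵇ⇒≤ 5 13 _) (∨ᵈ-introʳ p (disj q qs))
Disj-++-introˡ p (r ∷ rs) (q ∷ qs) = ∨ᵈ-monoˡ p (Disj-++-introˡ r rs (q ∷ qs))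

Disj-++-introʳ : ∀ p ps qs →
                 HasCFProofOfLength (length⁺ (p ∷ ps) * 4 + size (Disj qs) * 13)
                                    ⟨ Disj qs ⟩⇒⟨ Disj ((p ∷ ps) ⁺++⁺ qs) ⟩
Disj-++-introʳ p []       (q ∷ qs) = ∨ᵈ-introˡ p (identity (disj q qs))
Disj-++-introʳ p (r ∷ rs) (q ∷ qs) = ∨ᵈ-introˡ p (Disj-++-introʳ r rs (q ∷ qs))

Disj-++-elim : ∀ p ps qs →
               HasCFProofOfLength (length⁺ (p ∷ ps) * 15 + size (Disj qs) * 13)
                                  ((Disj ((p ∷ ps) ⁺++⁺ qs) ∷ []) ⇒
                                   (Disj (p ∷ ps) ∷ Disj qs ∷ []))
Disj-++-elim p []       (q ∷ qs) =
  lengthen (+-monoˡ-≤ (size (disj q qs) * 13) (≤ᵇ⇒≤ 6 15 _))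
           (∨ᵈ-elim p (identity (disj q qs)))
Disj-++-elim p (r ∷ rs) (q ∷ qs) = ∨ᵈ-monoˡ-ctx p (Disj-++-elim r rs (q ∷ qs))

size-conj : ∀ p ps → size (conj p ps) ≤ length⁺ (p ∷ ps) * 2
size-conj p []       = s≤s z≤n
size-conj p (q ∷ qs) = s≤s (s≤s (size-conj q qs))

size-disj : ∀ p ps → size (disj p ps) ≤ length⁺ (p ∷ ps) * 2
size-disj p []       = s≤s z≤n
size-disj p (q ∷ qs) = subst (_≤ length⁺ (p ∷ q ∷ qs) * 2)
                             (sym (trans (+-assoc _ 1 1) (+-comm _ 2)))
                             (s≤s (s≤s (size-disj q qs)))

size-Conj-⁺++⁺ : ∀ ps qs → size (Conj (ps ⁺++⁺ qs)) ≤ (length⁺ ps + length⁺ qs) * 2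
size-Conj-⁺++⁺ ps@(p ∷ rs) qs@(q ∷ qs′) =
  subst (λ n → size (Conj (ps ⁺++⁺ qs)) ≤ n * 2) (length-⁺++⁺ ps qs)
        (size-conj p (rs ++ q ∷ qs′))

size-Disj-⁺++⁺ : ∀ ps qs → size (Disj (ps ⁺++⁺ qs)) ≤ (length⁺ ps + length⁺ qs) * 2
size-Disj-⁺++⁺ ps@(p ∷ rs) qs@(q ∷ qs′) =
  subst (λ n → size (Disj (ps ⁺++⁺ qs)) ≤ n * 2) (length-⁺++⁺ ps qs)
        (size-disj p (rs ++ q ∷ qs′))

seqSize-1⇒1-≤ : ∀ A B n → size A ≤ n * 2 → size B ≤ n * 2 →
                seqSize ⟨ A ⟩⇒⟨ B ⟩ ≤ n * 4
seqSize-1⇒1-≤ A B n A≤ B≤ = begin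
  size A + 0 + (size B + 0) ≡⟨ cong₂ _+_ (+-identityʳ (size A)) (+-identityʳ (size B)) ⟩
  size A + size B           ≤⟨ +-mono-≤ A≤ B≤ ⟩
  n * 2 + n * 2             ≡⟨ *-distribˡ-+ n 2 2 ⟨
  n * 4                     ∎
  where open ≤-Reasoning

seqSize-2⇒1-≤ : ∀ A B C x y → size A ≤ x * 2 → size B ≤ y * 2 → size C ≤ (x + y) * 2 →
                seqSize ((A ∷ B ∷ []) ⇒ (C ∷ [])) ≤ (x + y) * 4
seqSize-2⇒1-≤ A B C x y A≤ B≤ C≤ = begin
  size A + (size B + 0) + (size C + 0) ≡⟨ cong₂ (λ b c → size A + b + c)
                                                (+-identityʳ (size B)) (+-identityʳ (size C)) ⟩
  size A + size B + size C             ≤⟨ +-mono-≤ (+-mono-≤ A≤ B≤) C≤ ⟩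
  x * 2 + y * 2 + (x + y) * 2          ≡⟨ cong (_+ (x + y) * 2) (*-distribʳ-+ 2 x y) ⟨
  (x + y) * 2 + (x + y) * 2            ≡⟨ *-distribˡ-+ (x + y) 2 2 ⟨
  (x + y) * 4                          ∎
  where open ≤-Reasoning

seqSize-1⇒2-≤ : ∀ A B C x y → size A ≤ (x + y) * 2 → size B ≤ x * 2 → size C ≤ y * 2 →
                seqSize ((A ∷ []) ⇒ (B ∷ C ∷ [])) ≤ (x + y) * 4
seqSize-1⇒2-≤ A B C x y A≤ B≤ C≤ = begin
  size A + 0 + (size B + (size C + 0)) ≡⟨ cong₂ (λ a c → a + (size B + c))
                                                (+-identityʳ (size A)) (+-identityʳ (size C)) ⟩
  size A + (size B + size C)           ≤⟨ +-mono-≤ A≤ (+-mono-≤ B≤ C≤) ⟩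
  (x + y) * 2 + (x * 2 + y * 2)        ≡⟨ cong ((x + y) * 2 +_) (*-distribʳ-+ 2 x y) ⟨
  (x + y) * 2 + (x + y) * 2            ≡⟨ *-distribˡ-+ (x + y) 2 2 ⟨
  (x + y) * 4                          ∎
  where open ≤-Reasoning

length-≤ : ∀ {a} x y → a ≤ 26 → x * a ≤ (x + y) * 26
length-≤ x y a≤26 = *-mono-≤ (m≤m+n x y) a≤26

length-with-identity-≤ : ∀ {a s} x y → a ≤ 26 → s ≤ y * 2 → x * a + s * 13 ≤ (x + y) * 26
length-with-identity-≤ {a} {s} x y a≤26 s≤ = begin
  x * a + s * 13      ≤⟨ +-mono-≤ (*-monoʳ-≤ x a≤26) (*-monoˡ-≤ 13 s≤) ⟩
  x * 26 + y * 2 * 13 ≡⟨ cong (x * 26 +_) (*-assoc y 2 13) ⟩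
  x * 26 + y * 26     ≡⟨ *-distribʳ-+ 26 x y ⟨
  (x + y) * 26        ∎
  where open ≤-Reasoning

square-bound : ∀ {m S} n → HasCFProofOfLength m S → m ≤ n * 26 → seqSize S ≤ n * 4 →
               HasCFProof S (104 * n ^ 2)
square-bound {m} {S} n (byLength (d , c , h)) m≤ S≤ = d , c , (begin
  proofSize d      ≤⟨ h ⟩
  m * seqSize S    ≤⟨ *-mono-≤ m≤ S≤ ⟩
  n * 26 * (n * 4) ≡⟨ square n ⟩
  104 * n ^ 2      ∎)
  where
  open ≤-Reasoning
  square : ∀ k → k * 26 * (k * 4) ≡ 104 * (k * (k * 1))
  square = solve-∀

proposition3p4 : Σ ℕ λ c → Σ ℕ λ k → (ps qs : List⁺ Lit) →
    let n = length⁺ ps + length⁺ qs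
        b = c * n ^ k
    in HasCFProof ((Conj (ps ⁺++⁺ qs) ∷ []) ⇒ (Conj ps ∷ [])) b
     × HasCFProof ((Conj (ps ⁺++⁺ qs) ∷ []) ⇒ (Conj qs ∷ [])) b
     × HasCFProof ((Conj ps ∷ Conj qs ∷ []) ⇒ (Conj (ps ⁺++⁺ qs) ∷ [])) b
     × HasCFProof ((Disj ps ∷ []) ⇒ (Disj (ps ⁺++⁺ qs) ∷ [])) b
     × HasCFProof ((Disj qs ∷ []) ⇒ (Disj (ps ⁺++⁺ qs) ∷ [])) b
     × HasCFProof ((Disj (ps ⁺++⁺ qs) ∷ []) ⇒ (Disj ps ∷ Disj qs ∷ [])) b
proposition3p4 = 104 , 2 , λ where
  P@(p ∷ ps) Q@(q ∷ qs) →
    let x = length⁺ P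
        y = length⁺ Q
        n = x + y
        2x≤2n = *-monoˡ-≤ 2 (m≤m+n x y)
        2y≤2n = *-monoˡ-≤ 2 (m≤n+m y x)
    in square-bound n (Conj-++-elimˡ p ps Q)
         (length-≤ x y (≤ᵇ⇒≤ 9 26 _))
         (seqSize-1⇒1-≤ (Conj (P ⁺++⁺ Q)) (Conj P) n
            (size-Conj-⁺++⁺ P Q) (≤-trans (size-conj p ps) 2x≤2n))
     , square-bound n (Conj-++-elimʳ p ps Q)
         (length-with-identity-≤ x y (≤ᵇ⇒≤ 4 26 _) (size-conj q qs))
         (seqSize-1⇒1-≤ (Conj (P ⁺++⁺ Q)) (Conj Q) n
            (size-Conj-⁺++⁺ P Q) (≤-trans (size-conj q qs) 2y≤2n))
     , square-bound n (Conj-++-intro p ps Q)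
         (length-with-identity-≤ x y (≤ᵇ⇒≤ 11 26 _) (size-conj q qs))
         (seqSize-2⇒1-≤ (Conj P) (Conj Q) (Conj (P ⁺++⁺ Q)) x y
            (size-conj p ps) (size-conj q qs) (size-Conj-⁺++⁺ P Q))
     , square-bound n (Disj-++-introˡ p ps Q)
         (length-≤ x y (≤ᵇ⇒≤ 13 26 _))
         (seqSize-1⇒1-≤ (Disj P) (Disj (P ⁺++⁺ Q)) n
            (≤-trans (size-disj p ps) 2x≤2n) (size-Disj-⁺++⁺ P Q))
     , square-bound n (Disj-++-introʳ p ps Q)
         (length-with-identity-≤ x y (≤ᵇ⇒≤ 4 26 _) (size-disj q qs))
         (seqSize-1⇒1-≤ (Disj Q) (Disj (P ⁺++⁺ Q)) n
            (≤-trans (size-disj q qs) 2y≤2n) (size-Disj-⁺++⁺ P Q))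
     , square-bound n (Disj-++-elim p ps Q)
         (length-with-identity-≤ x y (≤ᵇ⇒≤ 15 26 _) (size-disj q qs))
         (seqSize-1⇒2-≤ (Disj (P ⁺++⁺ Q)) (Disj P) (Disj Q) x y
            (size-Disj-⁺++⁺ P Q) (size-disj p ps) (size-disj q qs))
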